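{- For every $\sigma\in\{132,213,231,312\}$ and every integer $m\ge0$, \[ \mathrm{p}_\sigma(2m)=\frac{1}{2m+1}\binom{3m}{m}\quad\text{and}\quad \mathrm{p}_\sigma(2m+1)=\frac{1}{2m+1}\binom{3m+1}{m+1}. \]
   Context: A parity-alternating permutation (PAP) of $[n]$ is a permutation $\pi$ with $\pi(i)\equiv i\pmod 2$ for all $i$. A permutation contains a pattern $\sigma$ if some subsequence of its one-line notation is order-isomorphic to $\sigma$, and avoids it otherwise. $\mathrm{p}_\sigma(n)$ is the number of PAPs of $[n]$ avoiding $\sigma$. -}

module Defs where

open import Data.Nat using (ℕ; zero; suc; _+_; _*_; _<_; _%_)
open import Data.List using (List; []; _∷_; length; map; upTo; lookup)
open import Data.List.Relation.Binary.Permutation.Propositional using (_↭_)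
open import Data.List.Relation.Binary.Sublist.Propositional using (_⊆_)
open import Data.List.Relation.Unary.Unique.Propositional using (Unique)
open import Data.List.Membership.Propositional using (_∈_)
open import Data.Fin using (Fin; toℕ; cast)
open import Data.Product using (Σ; _×_; ∃)
open import Relation.Binary.PropositionalEquality using (_≡_)
open import Relation.Nullary using (¬_)
open import Function.Bundles using (_⇔_)

IsPerm : ℕ → List ℕ → Set
IsPerm n π = π ↭ map suc (upTo n)

-- Parity condition: the entry at (1-based) position i is ≡ i (mod 2).
-- With 0-based index k the position is k+1.
ParityAlt : List ℕ → Set
ParityAlt π = (k : Fin (length π)) → lookup π k % 2 ≡ suc (toℕ k) % 2

IsPAP : ℕ → List ℕ → Set
IsPAP n π = IsPerm n π × ParityAlt π

OrderIso : List ℕ → List ℕ → Set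
OrderIso a b = Σ (length a ≡ length b) λ eq →
  (i j : Fin (length a)) →
    (lookup a i < lookup a j) ⇔ (lookup b (cast eq i) < lookup b (cast eq j))

Contains : List ℕ → List ℕ → Set
Contains π σ = ∃ λ s → (s ⊆ π) × OrderIso s σ

Avoids : List ℕ → List ℕ → Set
Avoids π σ = ¬ Contains π σ

HasCount : (List ℕ → Set) → ℕ → Set
HasCount P k = ∃ λ (L : List (List ℕ)) →
  Unique L × ((π : List ℕ) → (π ∈ L) ⇔ P π) × (length L ≡ k)

PAPcount : List ℕ → ℕ → ℕ → Set
PAPcount σ n k = HasCount (λ π → IsPAP n π × Avoids π σ) k

data Pattern : List ℕ → Set where
  p132 : Pattern (1 ∷ 3 ∷ 2 ∷ [])
  p213 : Pattern (2 ∷ 1 ∷ 3 ∷ [])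
  p231 : Pattern (2 ∷ 3 ∷ 1 ∷ [])
  p312 : Pattern (3 ∷ 1 ∷ 2 ∷ [])

{-# OPTIONS --safe #-}
-- Each σ ∈ {132, 213, 231, 312} is a triple whose middle entry is the largest or the smallest.
-- In a σ-avoiding arrangement of an interval, the entries on one side of the extreme value all lie
-- below those on the other side (which side is fixed by σ), and both sides are again σ-avoiding
-- arrangements of intervals. Keeping track of how the parities of values and positions line up on
-- each side, the number of parity-alternating avoiders of an interval of length n is R(n/2, 1) for
-- even n, and R((n-1)/2, 2) or 0 for odd n, where R(m, r) = r/(3m + r) C(3m + r, m) are the Raney
-- numbers of ternary forests: the decomposition reproduces their convolution
-- Σ R(i, r) R(j, s) = R(i + j, r + s). The closed form then gives the two binomial expressions.
module Submission where

open import Defs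
open import Data.Nat using (ℕ; zero; suc; _+_; _*_; _≤_; _<_; _%_; s≤s; z≤n; z<s; parity; ⌊_/2⌋)
open import Data.Nat.Properties
open import Data.Nat.Combinatorics using (_C_; nC1≡n; nCk+nC[k+1]≡[n+1]C[k+1])
open import Data.Nat.Tactic.RingSolver using (solve-∀)
open import Data.Parity.Base as ℙ using (Parity; 0ℙ; 1ℙ)
import Data.Parity.Properties as ℙₚ
open import Data.Parity.Properties using (+-homo-+) renaming (+-identityʳ to ℙ+-identityʳ; +-comm to ℙ+-comm)
import Algebra.Solver.Ring.Simple as RingSolver
import Algebra.Solver.Ring.AlmostCommutativeRing as ACR
open import Algebra.Properties.CommutativeSemigroup *-commutativeSemigroup using (x∙yz≈y∙xz)
open import Data.Fin using (Fin; toℕ) renaming (zero to fzero; suc to fsuc)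
open import Data.Fin.Properties using (cast-is-id)
open import Data.List using (List; []; _∷_; _++_; [_]; length; map; lookup; take; drop; upTo; applyUpTo; cartesianProductWith)
open import Data.List.Properties
  using (length-++; length-map; ++-assoc; ++-identityʳ; ++-cancelˡ; ∷-injective; ∷-injectiveʳ; take-[])
open import Data.List.Relation.Binary.Permutation.Propositional
  using (_↭_; refl; prep; ↭-sym; ↭-trans; ↭-reflexive; ↭⇒↭ₛ)
open import Data.List.Relation.Binary.Permutation.Propositional.Properties
  using (∈-resp-↭; ↭-length; ++⁺; ++⁺ʳ; ++-comm; shift; drop-mid; drop-∷; ∷↭∷ʳ; ↭-empty-inv)
import Data.List.Relation.Binary.Permutation.Setoid.Properties as ↭ₛ
open import Data.List.Relation.Binary.Sublist.Propositional as Sublist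
  using (_⊆_; []; _∷_; _∷ʳ_; ⊆-trans; ⊆-refl; from∈)
open import Data.List.Relation.Binary.Sublist.Propositional.Properties
  using (∷ˡ⁻) renaming (++⁺ to ⊆-++⁺; ++⁺ˡ to ⊆-++⁺ˡ; ++⁺ʳ to ⊆-++⁺ʳ)
open import Data.List.Relation.Unary.Unique.Propositional using (Unique)
import Data.List.Relation.Unary.Unique.Propositional.Properties as Unique
open import Data.List.Relation.Unary.All as All using ([]; tabulate)
open import Data.List.Relation.Unary.AllPairs using ([]; _∷_)
open import Data.List.Relation.Unary.Any using (here; there)
open import Data.List.Membership.Propositional using (_∈_; _∉_)
open import Data.List.Membership.Propositional.Properties
  using (∈-++⁺ˡ; ∈-++⁺ʳ; ∈-++⁻; ∈-∃++; ∈-map⁻; ∈-cartesianProductWith⁺; ∈-cartesianProductWith⁻)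
open import Data.Product using (Σ; _×_; _,_; proj₁; proj₂)
open import Data.Sum using (inj₁; inj₂)
open import Data.Unit using (⊤; tt)
open import Data.Empty using (⊥; ⊥-elim)
open import Function using (_∘_)
open import Function.Bundles using (_⇔_; mk⇔; Equivalence)
open import Relation.Nullary using (Dec; yes; no; ¬_)
open import Relation.Binary.Definitions using (tri<; tri≈; tri>)
open import Relation.Binary.PropositionalEquality hiding ([_])

-- Sums over antidiagonals

private variable A B : Set

foldAntidiagonal : (A → A → A) → (ℕ → ℕ → A) → ℕ → A
foldAntidiagonal _∙_ h zero    = h 0 0
foldAntidiagonal _∙_ h (suc n) = h 0 (suc n) ∙ foldAntidiagonal _∙_ (λ a c → h (suc a) c) n

foldAntidiagonal-homo : ∀ {_∙_ : A → A → A} {_⊕_ : B → B → B} (f : A → B) →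
                        (∀ x y → f (x ∙ y) ≡ f x ⊕ f y) →
                        ∀ h n → f (foldAntidiagonal _∙_ h n) ≡ foldAntidiagonal _⊕_ (λ a c → f (h a c)) n
foldAntidiagonal-homo f homo h zero    = refl
foldAntidiagonal-homo {_⊕_ = _⊕_} f homo h (suc n) =
  trans (homo _ _) (cong (f (h 0 (suc n)) ⊕_) (foldAntidiagonal-homo f homo (λ a c → h (suc a) c) n))

∈-foldAntidiagonal⁻ : ∀ (h : ℕ → ℕ → List A) n {x} → x ∈ foldAntidiagonal _++_ h n →
                      Σ ℕ λ a → Σ ℕ λ c → a + c ≡ n × x ∈ h a c
∈-foldAntidiagonal⁻ h zero    x∈ = 0 , 0 , refl , x∈
∈-foldAntidiagonal⁻ h (suc n) x∈ with ∈-++⁻ (h 0 (suc n)) x∈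
... | inj₁ x∈₀ = 0 , suc n , refl , x∈₀
... | inj₂ x∈′ with ∈-foldAntidiagonal⁻ (λ a c → h (suc a) c) n x∈′
...   | a , c , refl , x∈ₐ = suc a , c , refl , x∈ₐ

∈-foldAntidiagonal⁺ : ∀ (h : ℕ → ℕ → List A) a c {x} → x ∈ h a c → x ∈ foldAntidiagonal _++_ h (a + c)
∈-foldAntidiagonal⁺ h zero    zero    x∈ = x∈
∈-foldAntidiagonal⁺ h zero    (suc c) x∈ = ∈-++⁺ˡ x∈
∈-foldAntidiagonal⁺ h (suc a) c       x∈ =
  ∈-++⁺ʳ (h 0 (suc (a + c))) (∈-foldAntidiagonal⁺ (λ a c → h (suc a) c) a c x∈)

Unique-foldAntidiagonal : ∀ (h : ℕ → ℕ → List A) n → (∀ a c → a + c ≡ n → Unique (h a c)) →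
                          (∀ {a c a′ c′ x} → a + c ≡ n → a′ + c′ ≡ n →
                             x ∈ h a c → x ∈ h a′ c′ → a ≡ a′) →
                          Unique (foldAntidiagonal _++_ h n)
Unique-foldAntidiagonal h zero    unique _ = unique 0 0 refl
Unique-foldAntidiagonal h (suc n) unique separated =
  Unique.++⁺ (unique 0 (suc n) refl)
    (Unique-foldAntidiagonal (λ a c → h (suc a) c) n (λ a c eq → unique (suc a) c (cong suc eq))
      (λ e e′ x∈ x∈′ → suc-injective (separated (cong suc e) (cong suc e′) x∈ x∈′)))
    disjoint
  where
  disjoint : ∀ {x} → ¬ (x ∈ h 0 (suc n) × x ∈ foldAntidiagonal _++_ (λ a c → h (suc a) c) n)
  disjoint (x∈₀ , x∈′) with ∈-foldAntidiagonal⁻ (λ a c → h (suc a) c) n x∈′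
  ... | a , c , eq , x∈ₐ with () ← separated refl (cong suc eq) x∈₀ x∈ₐ

sumAntidiagonal : (ℕ → ℕ → ℕ) → ℕ → ℕ
sumAntidiagonal = foldAntidiagonal _+_

sumAntidiagonal-cong : ∀ {h h′} n → (∀ a c → a + c ≡ n → h a c ≡ h′ a c) →
                       sumAntidiagonal h n ≡ sumAntidiagonal h′ n
sumAntidiagonal-cong zero    eq = eq 0 0 refl
sumAntidiagonal-cong (suc n) eq =
  cong₂ _+_ (eq 0 (suc n) refl) (sumAntidiagonal-cong n (λ a c e → eq (suc a) c (cong suc e)))

sumAntidiagonal-zero : ∀ {h} n → (∀ a c → h a c ≡ 0) → sumAntidiagonal h n ≡ 0
sumAntidiagonal-zero zero    eq = eq 0 0
sumAntidiagonal-zero (suc n) eq =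
  cong₂ _+_ (eq 0 (suc n)) (sumAntidiagonal-zero n (λ a → eq (suc a)))

sumAntidiagonal-+ : ∀ {h h′} n → sumAntidiagonal (λ a c → h a c + h′ a c) n ≡
                                 sumAntidiagonal h n + sumAntidiagonal h′ n
sumAntidiagonal-+ zero = refl
sumAntidiagonal-+ {h} {h′} (suc n) =
  trans (cong (h 0 (suc n) + h′ 0 (suc n) +_) (sumAntidiagonal-+ n))
        (+-exchange (h 0 (suc n)) (h′ 0 (suc n)) _ _)
  where
  +-exchange : ∀ a b c d → (a + b) + (c + d) ≡ (a + c) + (b + d)
  +-exchange = solve-∀

twice : ℕ → ℕ
twice zero    = zero
twice (suc m) = suc (suc (twice m))

2*m≡twice : ∀ m → 2 * m ≡ twice m
2*m≡twice zero    = refl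
2*m≡twice (suc m) = cong suc (trans (+-suc m (m + 0)) (cong suc (2*m≡twice m)))

data ParityView : ℕ → Set where
  even : ∀ m → ParityView (twice m)
  odd  : ∀ m → ParityView (suc (twice m))

parityView : ∀ n → ParityView n
parityView zero = even 0
parityView (suc n) with parityView n
... | even m = odd m
... | odd  m = even (suc m)

parity-twice : ∀ m → parity (twice m) ≡ 0ℙ
parity-twice zero    = refl
parity-twice (suc m) = parity-twice m

parity-suc-twice : ∀ m → parity (suc (twice m)) ≡ 1ℙ
parity-suc-twice zero    = refl
parity-suc-twice (suc m) = parity-suc-twice m

⌊twice/2⌋ : ∀ m → ⌊ twice m /2⌋ ≡ m
⌊twice/2⌋ zero    = refl
⌊twice/2⌋ (suc m) = cong suc (⌊twice/2⌋ m)

⌊suc-twice/2⌋ : ∀ m → ⌊ suc (twice m) /2⌋ ≡ m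
⌊suc-twice/2⌋ zero    = refl
⌊suc-twice/2⌋ (suc m) = cong suc (⌊suc-twice/2⌋ m)

sumAntidiagonal-twice : ∀ m h → sumAntidiagonal h (twice (suc m)) ≡
  sumAntidiagonal (λ i j → h (twice i) (twice j)) (suc m)
    + sumAntidiagonal (λ i j → h (suc (twice i)) (suc (twice j))) m
sumAntidiagonal-twice zero    h = exchange (h 0 2) (h 1 1) (h 2 0)
  where
  exchange : ∀ a b c → a + (b + c) ≡ (a + c) + b
  exchange = solve-∀
sumAntidiagonal-twice (suc m) h rewrite sumAntidiagonal-twice m (λ a c → h (suc (suc a)) c) =
  exchange (h 0 (twice (suc (suc m)))) (h 1 (suc (twice (suc m)))) _ _
  where
  exchange : ∀ a b c d → a + (b + (c + d)) ≡ (a + c) + (b + d)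
  exchange = solve-∀

sumAntidiagonal-suc-twice : ∀ m h → sumAntidiagonal h (suc (twice m)) ≡
  sumAntidiagonal (λ i j → h (twice i) (suc (twice j))) m + sumAntidiagonal (λ i j → h (suc (twice i)) (twice j)) m
sumAntidiagonal-suc-twice zero    h = refl
sumAntidiagonal-suc-twice (suc m) h rewrite sumAntidiagonal-suc-twice m (λ a c → h (suc (suc a)) c) =
  exchange (h 0 (suc (twice (suc m)))) (h 1 (twice (suc m))) _ _
  where
  exchange : ∀ a b c d → a + (b + (c + d)) ≡ (a + c) + (b + d)
  exchange = solve-∀

-- Raney numbers

-- raney m r counts forests of r ternary trees with m internal nodes in total:
-- either the first tree is a leaf, or its root is replaced by its three subtrees.
raney : ℕ → ℕ → ℕ
raney zero    r       = 1
raney (suc m) zero    = 0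
raney (suc m) (suc r) = raney (suc m) r + raney m (3 + r)

raney-convolution : ∀ m r s → sumAntidiagonal (λ i j → raney i r * raney j s) m ≡ raney m (r + s)
raney-convolution zero    r       s = refl
raney-convolution (suc m) zero    s =
  trans (cong₂ _+_ (+-identityʳ (raney (suc m) s)) (sumAntidiagonal-zero m (λ _ _ → refl)))
        (+-identityʳ (raney (suc m) s))
raney-convolution (suc m) (suc r) s = begin
  raney (suc m) s + 0 + sumAntidiagonal (λ a c → (raney (suc a) r + raney a (3 + r)) * raney c s) m
    ≡⟨ cong (raney (suc m) s + 0 +_) (sumAntidiagonal-cong m (λ a c _ →
         *-distribʳ-+ (raney c s) (raney (suc a) r) (raney a (3 + r)))) ⟩
  raney (suc m) s + 0 + sumAntidiagonal (λ a c → raney (suc a) r * raney c s + raney a (3 + r) * raney c s) m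
    ≡⟨ cong (raney (suc m) s + 0 +_) (sumAntidiagonal-+ m) ⟩
  raney (suc m) s + 0 + (sumAntidiagonal (λ a c → raney (suc a) r * raney c s) m
                         + sumAntidiagonal (λ a c → raney a (3 + r) * raney c s) m)
    ≡⟨ +-assoc (raney (suc m) s + 0) _ _ ⟨
  sumAntidiagonal (λ a c → raney a r * raney c s) (suc m)
    + sumAntidiagonal (λ a c → raney a (3 + r) * raney c s) m
    ≡⟨ cong₂ _+_ (raney-convolution (suc m) r s) (raney-convolution m (3 + r) s) ⟩
  raney (suc m) (suc r + s) ∎
  where open ≡-Reasoning

pascal : ∀ n k → suc n C suc k ≡ n C k + n C suc k
pascal n k = sym (nCk+nC[k+1]≡[n+1]C[k+1] n k)

[1+k]*[1+n]C[1+k]≡[1+n]*nCk : ∀ n k → suc k * (suc n C suc k) ≡ suc n * (n C k)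
[1+k]*[1+n]C[1+k]≡[1+n]*nCk n zero = begin
  suc n C 1 + 0 ≡⟨ +-identityʳ _ ⟩
  suc n C 1     ≡⟨ nC1≡n (suc n) ⟩
  suc n         ≡⟨ *-identityʳ (suc n) ⟨
  suc n * 1     ∎
  where open ≡-Reasoning
[1+k]*[1+n]C[1+k]≡[1+n]*nCk zero (suc k) = *-zeroʳ (suc (suc k))
[1+k]*[1+n]C[1+k]≡[1+n]*nCk (suc n) (suc k) = begin
  suc (suc k) * (suc (suc n) C suc (suc k))
    ≡⟨ cong (suc (suc k) *_) (pascal (suc n) (suc k)) ⟩
  suc (suc k) * (suc n C suc k + suc n C suc (suc k))
    ≡⟨ *-distribˡ-+ (suc (suc k)) (suc n C suc k) _ ⟩
  (suc n C suc k + suc k * (suc n C suc k)) + suc (suc k) * (suc n C suc (suc k))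
    ≡⟨ cong₂ (λ u v → (suc n C suc k + u) + v) ([1+k]*[1+n]C[1+k]≡[1+n]*nCk n k)
                                                 ([1+k]*[1+n]C[1+k]≡[1+n]*nCk n (suc k)) ⟩
  (suc n C suc k + suc n * (n C k)) + suc n * (n C suc k)
    ≡⟨ +-assoc (suc n C suc k) _ _ ⟩
  suc n C suc k + (suc n * (n C k) + suc n * (n C suc k))
    ≡⟨ cong (suc n C suc k +_) (*-distribˡ-+ (suc n) (n C k) _) ⟨
  suc n C suc k + suc n * (n C k + n C suc k)
    ≡⟨ cong (λ t → suc n C suc k + suc n * t) (pascal n k) ⟨
  suc (suc n) * (suc n C suc k) ∎
  where open ≡-Reasoning

-- (n + 1) C(n, k) = (n + 1 - k) C(n + 1, k), with n = k + q so that no subtraction occurs.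
[1+n]*nCk≡[1+q]*[1+n]Ck : ∀ k q → suc (k + q) * ((k + q) C k) ≡ suc q * (suc (k + q) C k)
[1+n]*nCk≡[1+q]*[1+n]Ck zero    q = refl
[1+n]*nCk≡[1+q]*[1+n]Ck (suc k) q = +-cancelʳ-≡ _ _ _ (begin
  suc n * (n C suc k) + suc k * X
    ≡⟨ cong (suc n * (n C suc k) +_) ([1+k]*[1+n]C[1+k]≡[1+n]*nCk n k) ⟩
  suc n * (n C suc k) + suc n * (n C k)
    ≡⟨ *-distribˡ-+ (suc n) (n C suc k) (n C k) ⟨
  suc n * (n C suc k + n C k)
    ≡⟨ cong (suc n *_) (trans (+-comm (n C suc k) (n C k)) (sym (pascal n k))) ⟩
  suc n * X
    ≡⟨ split q k X ⟩
  suc q * X + suc k * X ∎)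
  where
  open ≡-Reasoning
  n = suc k + q
  X = suc n C suc k
  split : ∀ q k X → suc (suc (k + q)) * X ≡ suc q * X + suc k * X
  split = solve-∀

raney-closedForm : ∀ m r → (3 * m + r) * raney m r ≡ r * ((3 * m + r) C m)
raney-closedForm zero    r       = refl
raney-closedForm (suc m) zero    = *-zeroʳ (3 * suc m + 0)
raney-closedForm (suc m) (suc r) =
  subst (λ N → N * raney M (suc r) ≡ suc r * (N C M)) (sym (+-suc (3 * M) r))
    (*-cancelˡ-≡ _ _ K (begin
      K * (suc K * (raney M r + raney m (3 + r)))
        ≡⟨ regroup K (raney M r) (raney m (3 + r)) ⟩
      suc K * (K * raney M r + K * raney m (3 + r))
        ≡⟨ cong₂ (λ u v → suc K * (u + v)) (raney-closedForm (suc m) r) IH ⟩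
      suc K * (r * (K C M) + (3 + r) * (K C m))
        ≡⟨ distribute K r (K C M) (K C m) ⟩
      r * (suc K * (K C M)) + (3 + r) * (suc K * (K C m))
        ≡⟨ cong₂ (λ u v → r * u + (3 + r) * v)
             (subst (λ N → suc N * (N C M) ≡ suc q * (suc N C M)) (sym K≡M+q) ([1+n]*nCk≡[1+q]*[1+n]Ck M q))
             (sym ([1+k]*[1+n]C[1+k]≡[1+n]*nCk K m)) ⟩
      r * (suc q * (suc K C M)) + (3 + r) * (M * (suc K C M))
        ≡⟨ collect m r (suc K C M) ⟩
      (3 * M + r) * (suc r * (suc K C M)) ∎))
  where
  open ≡-Reasoning
  M = suc m
  K = 3 * M + r
  q = 2 * M + r
  K≡M+q : K ≡ M + q
  K≡M+q = +-assoc M (2 * M) r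
  IH : K * raney m (3 + r) ≡ (3 + r) * (K C m)
  IH = subst (λ N → N * raney m (3 + r) ≡ (3 + r) * (N C m)) (3m+[3+r]≡3[1+m]+r m r) (raney-closedForm m (3 + r))
    where
    3m+[3+r]≡3[1+m]+r : ∀ m r → 3 * m + (3 + r) ≡ 3 * suc m + r
    3m+[3+r]≡3[1+m]+r = solve-∀
  regroup : ∀ K a b → K * (suc K * (a + b)) ≡ suc K * (K * a + K * b)
  regroup = solve-∀
  distribute : ∀ K r a b → suc K * (r * a + (3 + r) * b) ≡ r * (suc K * a) + (3 + r) * (suc K * b)
  distribute = solve-∀
  collect : ∀ m r X → r * (suc (2 * suc m + r) * X) + (3 + r) * (suc m * X) ≡ (3 * suc m + r) * (suc r * X)
  collect = solve-∀

[1+3m]*3mCm≡[1+2m]*[1+3m]Cm : ∀ m → suc (3 * m) * ((3 * m) C m) ≡ suc (2 * m) * (suc (3 * m) C m)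
[1+3m]*3mCm≡[1+2m]*[1+3m]Cm m =
  subst (λ N → suc N * (N C m) ≡ suc (2 * m) * (suc N C m)) (m+2m≡3m m) ([1+n]*nCk≡[1+q]*[1+n]Ck m (2 * m))
  where
  m+2m≡3m : ∀ m → m + 2 * m ≡ 3 * m
  m+2m≡3m = solve-∀

[1+2m]*raney[m,1]≡3mCm : ∀ m → suc (2 * m) * raney m 1 ≡ (3 * m) C m
[1+2m]*raney[m,1]≡3mCm m = *-cancelˡ-≡ _ _ (suc (3 * m)) (begin
  suc (3 * m) * (suc (2 * m) * raney m 1)  ≡⟨ x∙yz≈y∙xz (suc (3 * m)) (suc (2 * m)) (raney m 1) ⟩
  suc (2 * m) * (suc (3 * m) * raney m 1)  ≡⟨ cong (suc (2 * m) *_) closedForm ⟩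
  suc (2 * m) * (suc (3 * m) C m)          ≡⟨ [1+3m]*3mCm≡[1+2m]*[1+3m]Cm m ⟨
  suc (3 * m) * ((3 * m) C m)              ∎)
  where
  open ≡-Reasoning
  closedForm : suc (3 * m) * raney m 1 ≡ suc (3 * m) C m
  closedForm = subst (λ N → N * raney m 1 ≡ N C m) (+-comm (3 * m) 1)
                 (trans (raney-closedForm m 1) (*-identityˡ _))

[1+2m]*raney[m,2]≡[1+3m]C[1+m] : ∀ m → suc (2 * m) * raney m 2 ≡ suc (3 * m) C suc m
[1+2m]*raney[m,2]≡[1+3m]C[1+m] m =
  *-cancelˡ-≡ _ _ (suc m) (*-cancelˡ-≡ _ _ (2 + P) (begin
    (2 + P) * (suc m * (suc (2 * m) * raney m 2))
      ≡⟨ reorder (2 + P) (suc m) (suc (2 * m)) (raney m 2) ⟩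
    suc (2 * m) * (suc m * ((2 + P) * raney m 2))
      ≡⟨ cong (λ t → suc (2 * m) * (suc m * t)) closedForm ⟩
    suc (2 * m) * (suc m * (2 * ((2 + P) C m)))
      ≡⟨ cong (suc (2 * m) *_) (double m ((2 + P) C m)) ⟩
    suc (2 * m) * ((2 + 2 * m) * ((2 + P) C m))
      ≡⟨ cong (suc (2 * m) *_) second ⟨
    suc (2 * m) * ((2 + P) * (suc P C m))
      ≡⟨ x∙yz≈y∙xz (suc (2 * m)) (2 + P) (suc P C m) ⟩
    (2 + P) * (suc (2 * m) * (suc P C m))
      ≡⟨ cong ((2 + P) *_) ([1+3m]*3mCm≡[1+2m]*[1+3m]Cm m) ⟨
    (2 + P) * (suc P * (P C m))
      ≡⟨ cong ((2 + P) *_) ([1+k]*[1+n]C[1+k]≡[1+n]*nCk P m) ⟨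
    (2 + P) * (suc m * (suc P C suc m)) ∎))
  where
  open ≡-Reasoning
  P = 3 * m
  closedForm : (2 + P) * raney m 2 ≡ 2 * ((2 + P) C m)
  closedForm = subst (λ N → N * raney m 2 ≡ 2 * (N C m)) (+-comm P 2) (raney-closedForm m 2)
  second : (2 + P) * (suc P C m) ≡ (2 + 2 * m) * ((2 + P) C m)
  second = subst (λ N → suc N * (N C m) ≡ (2 + 2 * m) * (suc N C m)) (m+[1+2m]≡1+3m m)
             ([1+n]*nCk≡[1+q]*[1+n]Ck m (suc (2 * m)))
    where
    m+[1+2m]≡1+3m : ∀ m → m + suc (2 * m) ≡ suc (3 * m)
    m+[1+2m]≡1+3m = solve-∀
  reorder : ∀ a b c d → a * (b * (c * d)) ≡ c * (b * (a * d))
  reorder = solve-∀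
  double : ∀ m x → suc m * (2 * x) ≡ (2 + 2 * m) * x
  double = solve-∀

-- Parity-alternating lists

Alternating : ℕ → List ℕ → Set
Alternating r []       = ⊤
Alternating r (x ∷ xs) = parity x ≡ parity r × Alternating (suc r) xs

Alternating-++⁻ : ∀ r xs ys → Alternating r (xs ++ ys) → Alternating r xs × Alternating (length xs + r) ys
Alternating-++⁻ r []       ys h       = tt , h
Alternating-++⁻ r (x ∷ xs) ys (p , h) with Alternating-++⁻ (suc r) xs ys h
... | hxs , hys = (p , hxs) , subst (λ s → Alternating s ys) (+-suc (length xs) r) hys

Alternating-++⁺ : ∀ r xs ys → Alternating r xs → Alternating (length xs + r) ys → Alternating r (xs ++ ys)
Alternating-++⁺ r []       ys _         h = h
Alternating-++⁺ r (x ∷ xs) ys (p , hxs) h =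
  p , Alternating-++⁺ (suc r) xs ys hxs (subst (λ s → Alternating s ys) (sym (+-suc (length xs) r)) h)

fromParity : Parity → ℕ
fromParity 0ℙ = 0
fromParity 1ℙ = 1

%2≡fromParity : ∀ n → n % 2 ≡ fromParity (parity n)
%2≡fromParity zero          = refl
%2≡fromParity (suc zero)    = refl
%2≡fromParity (suc (suc n)) = %2≡fromParity n

fromParity-injective : ∀ {p q} → fromParity p ≡ fromParity q → p ≡ q
fromParity-injective {0ℙ} {0ℙ} _ = refl
fromParity-injective {1ℙ} {1ℙ} _ = refl

%2≡⇔parity≡ : ∀ m n → m % 2 ≡ n % 2 ⇔ parity m ≡ parity n
%2≡⇔parity≡ m n = mk⇔
  (λ eq → fromParity-injective (trans (sym (%2≡fromParity m)) (trans eq (%2≡fromParity n))))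
  (λ eq → trans (%2≡fromParity m) (trans (cong fromParity eq) (sym (%2≡fromParity n))))

lookup-%2⇔Alternating : ∀ r π → ((k : Fin (length π)) → lookup π k % 2 ≡ (r + toℕ k) % 2) ⇔ Alternating r π
lookup-%2⇔Alternating r []       = mk⇔ (λ _ → tt) (λ _ ())
lookup-%2⇔Alternating r (x ∷ xs) = mk⇔
  (λ h → Equivalence.to (%2≡⇔parity≡ x r) (trans (h fzero) r+0≡r)
       , Equivalence.to IH (λ k → trans (h (fsuc k)) (r+1+k k)))
  (λ { (p , h) → λ { fzero    → trans (Equivalence.from (%2≡⇔parity≡ x r) p) (sym r+0≡r)
                   ; (fsuc k) → trans (Equivalence.from IH h k) (sym (r+1+k k)) } })
  where
  IH = lookup-%2⇔Alternating (suc r) xs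
  r+0≡r : (r + 0) % 2 ≡ r % 2
  r+0≡r = cong (_% 2) (+-identityʳ r)
  r+1+k : ∀ k → (r + suc (toℕ k)) % 2 ≡ (suc r + toℕ k) % 2
  r+1+k k = cong (_% 2) (+-suc r (toℕ k))

-- Intervals

interval : ℕ → ℕ → List ℕ
interval lo zero    = []
interval lo (suc n) = lo ∷ interval (suc lo) n

∈-interval⁻ : ∀ {lo n x} → x ∈ interval lo n → lo ≤ x × x < lo + n
∈-interval⁻ {lo} {suc n} (here refl) = ≤-refl , m<m+n lo z<s
∈-interval⁻ {lo} {suc n} {x} (there p) with ∈-interval⁻ p
... | lo<x , x<lo+n = <⇒≤ lo<x , subst (x <_) (sym (+-suc lo n)) x<lo+n

length-interval : ∀ lo n → length (interval lo n) ≡ n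
length-interval lo zero    = refl
length-interval lo (suc n) = cong suc (length-interval (suc lo) n)

interval-++ : ∀ lo a c → interval lo (a + c) ≡ interval lo a ++ interval (lo + a) c
interval-++ lo zero    c rewrite +-identityʳ lo = refl
interval-++ lo (suc a) c rewrite +-suc lo a = cong (lo ∷_) (interval-++ (suc lo) a c)

interval-∷ʳ : ∀ lo n → interval lo (suc n) ≡ interval lo n ++ [ lo + n ]
interval-∷ʳ lo n = trans (cong (interval lo) (+-comm 1 n)) (interval-++ lo n 1)

Unique-interval : ∀ lo n → Unique (interval lo n)
Unique-interval lo zero    = []
Unique-interval lo (suc n) =
  tabulate (λ x∈ lo≡x → <-irrefl lo≡x (proj₁ (∈-interval⁻ x∈))) ∷ Unique-interval (suc lo) n

map-suc-applyUpTo : ∀ n (f : ℕ → ℕ) lo → (∀ i → suc (f i) ≡ lo + i) → map suc (applyUpTo f n) ≡ interval lo n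
map-suc-applyUpTo zero    f lo eq = refl
map-suc-applyUpTo (suc n) f lo eq =
  cong₂ _∷_ (trans (eq 0) (+-identityʳ lo))
            (map-suc-applyUpTo n (λ i → f (suc i)) (suc lo) (λ i → trans (eq (suc i)) (+-suc lo i)))

map-suc-upTo : ∀ n → map suc (upTo n) ≡ interval 1 n
map-suc-upTo n = map-suc-applyUpTo n (λ i → i) 1 (λ _ → refl)

Unique-resp-↭ : ∀ {xs ys : List ℕ} → xs ↭ ys → Unique xs → Unique ys
Unique-resp-↭ p = ↭ₛ.Unique-resp-↭ (setoid ℕ) (↭⇒↭ₛ p)

↭-cancelˡ : ∀ (xs : List ℕ) {ys zs} → xs ++ ys ↭ xs ++ zs → ys ↭ zs
↭-cancelˡ []       p = p
↭-cancelˡ (x ∷ xs) p = ↭-cancelˡ xs (drop-∷ p)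

Unique-++⇒disjoint : ∀ (xs : List ℕ) {ys x z} → Unique (xs ++ ys) → x ∈ xs → z ∈ ys → x ≢ z
Unique-++⇒disjoint (_ ∷ xs) (x∉ ∷ _) (here refl) z∈ = All.lookup x∉ (∈-++⁺ʳ xs z∈)
Unique-++⇒disjoint (_ ∷ xs) (_ ∷ u)  (there x∈) z∈ = Unique-++⇒disjoint xs u x∈ z∈

-- The top element L + k - 1 lies in β unless β is empty; remove it and recurse.
lowerPart-↭-interval : ∀ k L (α β : List ℕ) → α ++ β ↭ interval L k →
                       (∀ {x z} → x ∈ α → z ∈ β → x < z) → α ↭ interval L (length α)
lowerPart-↭-interval zero L []      β p α<β = refl
lowerPart-↭-interval zero L (_ ∷ _) β p α<β with () ← ↭-empty-inv p
lowerPart-↭-interval (suc k) L α β p α<β with ∈-++⁻ α (∈-resp-↭ (↭-sym p) top∈)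
  where
  top∈ : L + k ∈ interval L (suc k)
  top∈ = subst (L + k ∈_) (sym (interval-∷ʳ L k)) (∈-++⁺ʳ (interval L k) (here refl))
... | inj₁ top∈α = α-is-everything β p (α<β top∈α)
  where
  α-is-everything : ∀ β → α ++ β ↭ interval L (suc k) → (∀ {z} → z ∈ β → L + k < z) →
                    α ↭ interval L (length α)
  α-is-everything [] p _ =
    subst (λ m → α ↭ interval L m) (sym (trans (↭-length pα) (length-interval L (suc k)))) pα
    where
    pα : α ↭ interval L (suc k)
    pα = ↭-trans (↭-reflexive (sym (++-identityʳ α))) p
  α-is-everything (y ∷ β) p top<β = ⊥-elim (<⇒≱ (top<β (here refl)) (≤-pred y<1+top))
    where
    y<1+top : y < suc (L + k)
    y<1+top = subst (y <_) (+-suc L k) (proj₂ (∈-interval⁻ (∈-resp-↭ p (∈-++⁺ʳ α (here refl)))))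
... | inj₂ top∈β with β₁ , β₂ , refl ← ∈-∃++ top∈β =
  lowerPart-↭-interval k L α (β₁ ++ β₂) p′ (λ x∈ z∈ → α<β x∈ (lift z∈))
  where
  p′ : α ++ (β₁ ++ β₂) ↭ interval L k
  p′ = ↭-trans (↭-reflexive (sym (++-assoc α β₁ β₂)))
       (↭-trans (drop-mid (α ++ β₁) (interval L k)
                  (↭-trans (↭-reflexive (++-assoc α β₁ _)) (↭-trans p (↭-reflexive (interval-∷ʳ L k)))))
                (↭-reflexive (++-identityʳ (interval L k))))
  lift : ∀ {z} → z ∈ β₁ ++ β₂ → z ∈ β₁ ++ [ L + k ] ++ β₂
  lift z∈ with ∈-++⁻ β₁ z∈
  ... | inj₁ z∈β₁ = ∈-++⁺ˡ z∈β₁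
  ... | inj₂ z∈β₂ = ∈-++⁺ʳ β₁ (there z∈β₂)

split-↭-interval : ∀ L (α β : List ℕ) → α ++ β ↭ interval L (length α + length β) →
                   (∀ {x z} → x ∈ α → z ∈ β → x < z) →
                   α ↭ interval L (length α) × β ↭ interval (L + length α) (length β)
split-↭-interval L α β p α<β = pα , ↭-cancelˡ (interval L (length α)) (↭-trans (++⁺ʳ β (↭-sym pα))
  (↭-trans p (↭-reflexive (interval-++ L (length α) (length β)))))
  where
  pα = lowerPart-↭-interval _ L α β p α<β

-- Peaked triples

data Dir : Set where
  ↑ ↓ : Dir

infix 4 _<[_]_

_<[_]_ : ℕ → Dir → ℕ → Set
x <[ ↑ ] y = x < y
x <[ ↓ ] y = y < x

reverse : Dir → Dir
reverse ↑ = ↓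
reverse ↓ = ↑

<[]-reverse : ∀ d {x y} → x <[ d ] y → y <[ reverse d ] x
<[]-reverse ↑ x<y = x<y
<[]-reverse ↓ y<x = y<x

<[]-asym : ∀ d {x y} → x <[ d ] y → y <[ d ] x → ⊥
<[]-asym ↑ = <-asym
<[]-asym ↓ = <-asym

<[]-connex : ∀ d {x y} → x ≢ y → ¬ y <[ d ] x → x <[ d ] y
<[]-connex d {x} {y} x≢y y≮x with <-cmp x y | d
... | tri< x<y _ _ | ↑ = x<y
... | tri< x<y _ _ | ↓ = ⊥-elim (y≮x x<y)
... | tri≈ _ x≡y _ | _ = ⊥-elim (x≢y x≡y)
... | tri> _ _ y<x | ↑ = ⊥-elim (y≮x y<x)
... | tri> _ _ y<x | ↓ = y<x

-- y is the maximum (peak = ↑) or the minimum (peak = ↓) of the triple, and x, z violate the order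
-- blocks that an avoider imposes between the entries on the two sides of its extreme value.
Peaked : Dir → Dir → ℕ → ℕ → ℕ → Set
Peaked peak blocks x y z = x <[ peak ] y × z <[ peak ] y × z <[ blocks ] x

ContainsPeaked : Dir → Dir → List ℕ → Set
ContainsPeaked peak blocks π =
  Σ ℕ λ x → Σ ℕ λ y → Σ ℕ λ z → (x ∷ y ∷ z ∷ []) ⊆ π × Peaked peak blocks x y z

peakOf blocksOf : ∀ {σ} → Pattern σ → Dir
peakOf p132 = ↑
peakOf p213 = ↓
peakOf p231 = ↑
peakOf p312 = ↓
blocksOf p132 = ↓
blocksOf p213 = ↓
blocksOf p231 = ↑
blocksOf p312 = ↑

Pattern-peaked : ∀ {σ} (P : Pattern σ) → Σ ℕ λ p → Σ ℕ λ q → Σ ℕ λ r →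
                 σ ≡ p ∷ q ∷ r ∷ [] × Peaked (peakOf P) (blocksOf P) p q r
Pattern-peaked p132 = 1 , 3 , 2 , refl , s≤s (s≤s z≤n) , s≤s (s≤s (s≤s z≤n)) , s≤s (s≤s z≤n)
Pattern-peaked p213 = 2 , 1 , 3 , refl , s≤s (s≤s z≤n) , s≤s (s≤s z≤n) , s≤s (s≤s (s≤s z≤n))
Pattern-peaked p231 = 2 , 3 , 1 , refl , s≤s (s≤s (s≤s z≤n)) , s≤s (s≤s z≤n) , s≤s (s≤s z≤n)
Pattern-peaked p312 = 3 , 1 , 2 , refl , s≤s (s≤s z≤n) , s≤s (s≤s z≤n) , s≤s (s≤s (s≤s z≤n))

same-<[] : ∀ d {a b c e} → a <[ d ] b → c <[ d ] e → (a < b) ⇔ (c < e)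
same-<[] ↑ a<b c<e = mk⇔ (λ _ → c<e) (λ _ → a<b)
same-<[] ↓ b<a e<c = mk⇔ (λ a<b → ⊥-elim (<-asym a<b b<a)) (λ c<e → ⊥-elim (<-asym c<e e<c))

irrefl-⇔ : ∀ a c → (a < a) ⇔ (c < c)
irrefl-⇔ a c = mk⇔ (λ a<a → ⊥-elim (<-irrefl refl a<a)) (λ c<c → ⊥-elim (<-irrefl refl c<c))

Peaked⇒same-order : ∀ {d e x y z p q r} → Peaked d e x y z → Peaked d e p q r →
                     (i j : Fin 3) → (lookup (x ∷ y ∷ z ∷ []) i < lookup (x ∷ y ∷ z ∷ []) j)
                                   ⇔ (lookup (p ∷ q ∷ r ∷ []) i < lookup (p ∷ q ∷ r ∷ []) j)
Peaked⇒same-order {d} {e} (xy , zy , zx) (pq , rq , rp) = λ where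
  fzero               fzero               → irrefl-⇔ _ _
  fzero               (fsuc fzero)        → same-<[] d xy pq
  fzero               (fsuc (fsuc fzero)) → same-<[] (reverse e) (<[]-reverse e zx) (<[]-reverse e rp)
  (fsuc fzero)        fzero               → same-<[] (reverse d) (<[]-reverse d xy) (<[]-reverse d pq)
  (fsuc fzero)        (fsuc fzero)        → irrefl-⇔ _ _
  (fsuc fzero)        (fsuc (fsuc fzero)) → same-<[] (reverse d) (<[]-reverse d zy) (<[]-reverse d rq)
  (fsuc (fsuc fzero)) fzero               → same-<[] e zx rp
  (fsuc (fsuc fzero)) (fsuc fzero)        → same-<[] d zy rq
  (fsuc (fsuc fzero)) (fsuc (fsuc fzero)) → irrefl-⇔ _ _

Peaked⇒OrderIso : ∀ {d e x y z p q r} → Peaked d e x y z → Peaked d e p q r →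
                  OrderIso (x ∷ y ∷ z ∷ []) (p ∷ q ∷ r ∷ [])
Peaked⇒OrderIso {x = x} {y} {z} {p} {q} {r} pk pk′ = refl , λ i j →
  subst₂ (λ i′ j′ → (lookup xyz i < lookup xyz j) ⇔ (lookup pqr i′ < lookup pqr j′))
         (sym (cast-is-id refl i)) (sym (cast-is-id refl j)) (Peaked⇒same-order pk pk′ i j)
  where
  xyz = x ∷ y ∷ z ∷ []
  pqr = p ∷ q ∷ r ∷ []

transport-<[] : ∀ d {a b c e} → (a < b) ⇔ (c < e) → (b < a) ⇔ (e < c) → c <[ d ] e → a <[ d ] b
transport-<[] ↑ ab _  = Equivalence.from ab
transport-<[] ↓ _  ba = Equivalence.from ba

OrderIso⇒Peaked : ∀ {d e s p q r} → OrderIso s (p ∷ q ∷ r ∷ []) → Peaked d e p q r →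
                  Σ ℕ λ x → Σ ℕ λ y → Σ ℕ λ z → s ≡ x ∷ y ∷ z ∷ [] × Peaked d e x y z
OrderIso⇒Peaked {d} {e} {x ∷ y ∷ z ∷ []} (_ , iso) (pq , rq , rp) =
  x , y , z , refl ,
  transport-<[] d (iso fzero (fsuc fzero)) (iso (fsuc fzero) fzero) pq ,
  transport-<[] d (iso (fsuc (fsuc fzero)) (fsuc fzero)) (iso (fsuc fzero) (fsuc (fsuc fzero))) rq ,
  transport-<[] e (iso (fsuc (fsuc fzero)) fzero) (iso fzero (fsuc (fsuc fzero))) rp

Contains⇔ContainsPeaked : ∀ {σ π} (P : Pattern σ) → Contains π σ ⇔ ContainsPeaked (peakOf P) (blocksOf P) π
Contains⇔ContainsPeaked {π = π} P with Pattern-peaked P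
... | p , q , r , refl , pk = mk⇔
  (λ { (s , s⊆π , iso) → let x , y , z , s≡xyz , pk′ = OrderIso⇒Peaked iso pk
                          in x , y , z , subst (_⊆ π) s≡xyz s⊆π , pk′ })
  (λ { (x , y , z , s⊆π , pk′) → x ∷ y ∷ z ∷ [] , s⊆π , Peaked⇒OrderIso pk′ pk })

head∈ : ∀ {x : ℕ} {xs ys} → x ∷ xs ⊆ ys → x ∈ ys
head∈ τ = Sublist.lookup τ (here refl)

⊆-++-split : ∀ {xs : List ℕ} α {ys} → xs ⊆ α ++ ys → Σ ℕ λ k → take k xs ⊆ α × drop k xs ⊆ ys
⊆-++-split []      τ        = 0 , [] , τ
⊆-++-split (a ∷ α) (.a ∷ʳ τ) with ⊆-++-split α τ
... | k , τ₁ , τ₂ = k , a ∷ʳ τ₁ , τ₂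
⊆-++-split (a ∷ α) (x≡a ∷ τ) with ⊆-++-split α τ
... | k , τ₁ , τ₂ = suc k , x≡a ∷ τ₁ , τ₂

ContainsPeaked-⊆ : ∀ {d e xs ys} → xs ⊆ ys → ContainsPeaked d e xs → ContainsPeaked d e ys
ContainsPeaked-⊆ τ (x , y , z , τ′ , pk) = x , y , z , ⊆-trans τ′ τ , pk

module _ (peak blocks : Dir) where

  PeakFree : List ℕ → Set
  PeakFree π = ¬ ContainsPeaked peak blocks π

  -- Each way of distributing x, y, z over α, v and β contradicts one of the hypotheses.
  PeakFree-join : ∀ α v β → PeakFree α → PeakFree β →
                  (∀ {x z} → x ∈ α → z ∈ β → x <[ blocks ] z) →
                  (∀ {w} → w ∈ α → w <[ peak ] v) → (∀ {w} → w ∈ β → w <[ peak ] v) →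
                  PeakFree (α ++ v ∷ β)
  PeakFree-join α v β free-α free-β α<β α<v β<v (x , y , z , τ , pk@(xy , zy , zx))
    with ⊆-++-split α τ
  ... | zero , _ , (.v ∷ʳ τ₂)            = free-β (x , y , z , τ₂ , pk)
  ... | zero , _ , (refl ∷ τ₂)           = <[]-asym peak xy (β<v (head∈ τ₂))
  ... | suc zero , τ₁ , τ₂               = <[]-asym blocks zx (α<β (head∈ τ₁) (z∈β τ₂))
    where
    z∈β : y ∷ z ∷ [] ⊆ v ∷ β → z ∈ β
    z∈β (.v ∷ʳ τ) = head∈ (∷ˡ⁻ τ)
    z∈β (refl ∷ τ) = head∈ τ
  ... | suc (suc zero) , τ₁ , (.v ∷ʳ τ₂) = <[]-asym blocks zx (α<β (head∈ τ₁) (head∈ τ₂))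
  ... | suc (suc zero) , τ₁ , (refl ∷ _) = <[]-asym peak zy (α<v (head∈ (∷ˡ⁻ τ₁)))
  ... | suc (suc (suc k)) , τ₁ , _       =
    free-α (x , y , z , subst (λ t → x ∷ y ∷ z ∷ t ⊆ α) (take-[] k) τ₁ , pk)

  PeakFree-blocks : ∀ α v β → PeakFree (α ++ v ∷ β) →
                    (∀ {w} → w ∈ α → w <[ peak ] v) → (∀ {w} → w ∈ β → w <[ peak ] v) →
                    (∀ {x z} → x ∈ α → z ∈ β → x ≢ z) →
                    ∀ {x z} → x ∈ α → z ∈ β → x <[ blocks ] z
  PeakFree-blocks α v β free α<v β<v distinct x∈ z∈ =
    <[]-connex blocks (distinct x∈ z∈) λ zx →
      free (_ , v , _ , ⊆-++⁺ (from∈ x∈) (refl ∷ from∈ z∈) , α<v x∈ , β<v z∈ , zx)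

  PeakFree-⊆ : ∀ {xs ys} → xs ⊆ ys → PeakFree ys → PeakFree xs
  PeakFree-⊆ τ free c = free (ContainsPeaked-⊆ τ c)

-- Splitting an interval at its extreme value

-- The interval [lo, lo + n] is its extreme value peakValue plus the interval of length n starting
-- at restStart, which splits into a left block of length a and a right block of length c.
peakValue : Dir → ℕ → ℕ → ℕ
peakValue ↑ lo n = lo + n
peakValue ↓ lo n = lo

restStart : Dir → ℕ → ℕ
restStart ↑ lo = lo
restStart ↓ lo = suc lo

leftStart rightStart : Dir → ℕ → ℕ → ℕ → ℕ
leftStart  ↑ L a c = L
leftStart  ↓ L a c = L + c
rightStart ↑ L a c = L + a
rightStart ↓ L a c = L

interval-peak : ∀ peak lo n → interval lo (suc n) ↭ peakValue peak lo n ∷ interval (restStart peak lo) n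
interval-peak ↑ lo n = ↭-trans (↭-reflexive (interval-∷ʳ lo n)) (↭-sym (∷↭∷ʳ (lo + n) (interval lo n)))
interval-peak ↓ lo n = refl

∈-rest⇒<[peak] : ∀ peak {lo n w} → w ∈ interval (restStart peak lo) n → w <[ peak ] peakValue peak lo n
∈-rest⇒<[peak] ↑ w∈ = proj₂ (∈-interval⁻ w∈)
∈-rest⇒<[peak] ↓ w∈ = proj₁ (∈-interval⁻ w∈)

interval-blocks : ∀ blocks L a c →
                  interval (leftStart blocks L a c) a ++ interval (rightStart blocks L a c) c ↭ interval L (a + c)
interval-blocks ↑ L a c = ↭-reflexive (sym (interval-++ L a c))
interval-blocks ↓ L a c = ↭-trans (++-comm (interval (L + c) a) (interval L c))
  (↭-reflexive (trans (sym (interval-++ L c a)) (cong (interval L) (+-comm c a))))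

∈-blocks⇒<[blocks] : ∀ blocks {L a c x z} → x ∈ interval (leftStart blocks L a c) a →
                     z ∈ interval (rightStart blocks L a c) c → x <[ blocks ] z
∈-blocks⇒<[blocks] ↑ x∈ z∈ = <-≤-trans (proj₂ (∈-interval⁻ x∈)) (proj₁ (∈-interval⁻ z∈))
∈-blocks⇒<[blocks] ↓ x∈ z∈ = <-≤-trans (proj₂ (∈-interval⁻ z∈)) (proj₁ (∈-interval⁻ x∈))

interval-blocks⁻ : ∀ blocks L (α β : List ℕ) → α ++ β ↭ interval L (length α + length β) →
                   (∀ {x z} → x ∈ α → z ∈ β → x <[ blocks ] z) →
                   α ↭ interval (leftStart blocks L (length α) (length β)) (length α) ×
                   β ↭ interval (rightStart blocks L (length α) (length β)) (length β)
interval-blocks⁻ ↑ L α β p α<β = split-↭-interval L α β p α<β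
interval-blocks⁻ ↓ L α β p α>β =
  let pβ , pα = split-↭-interval L β α p′ (λ z∈ x∈ → α>β x∈ z∈) in pα , pβ
  where
  p′ : β ++ α ↭ interval L (length β + length α)
  p′ = ↭-trans (++-comm β α) (subst (λ m → α ++ β ↭ interval L m) (+-comm (length α) (length β)) p)


-- Enumerating the avoiders

when : {P : Set} → Dec P → List A → List A
when (yes _) xs = xs
when (no _)  xs = []

∈-when⁻ : ∀ {P : Set} (d : Dec P) {xs : List A} {x} → x ∈ when d xs → P × x ∈ xs
∈-when⁻ (yes p) x∈ = p , x∈

∈-when⁺ : ∀ {P : Set} (d : Dec P) {xs : List A} {x} → P → x ∈ xs → x ∈ when d xs
∈-when⁺ (yes _) _ x∈ = x∈
∈-when⁺ (no ¬p) p _  = ⊥-elim (¬p p)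

Unique-when : ∀ {P : Set} (d : Dec P) {xs : List A} → (P → Unique xs) → Unique (when d xs)
Unique-when (yes p) unique = unique p
Unique-when (no _)  _      = []

length-cartesianProductWith : ∀ {X : Set} (f : A → B → X) xs ys →
                              length (cartesianProductWith f xs ys) ≡ length xs * length ys
length-cartesianProductWith f []       ys = refl
length-cartesianProductWith f (x ∷ xs) ys =
  trans (length-++ (map (f x) ys)) (cong₂ _+_ (length-map (f x) ys) (length-cartesianProductWith f xs ys))

∉-++-∷-injective : ∀ (α α′ : List ℕ) {v β β′} → v ∉ α → v ∉ α′ →
                   α ++ v ∷ β ≡ α′ ++ v ∷ β′ → α ≡ α′
∉-++-∷-injective []      []        _   _    _  = refl
∉-++-∷-injective []      (_ ∷ _)   _   v∉α′ eq = ⊥-elim (v∉α′ (here (proj₁ (∷-injective eq))))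
∉-++-∷-injective (_ ∷ _) []        v∉α _    eq = ⊥-elim (v∉α (here (sym (proj₁ (∷-injective eq)))))
∉-++-∷-injective (a ∷ α) (_ ∷ α′)  v∉α v∉α′ eq with refl , eq′ ← ∷-injective eq =
  cong (a ∷_) (∉-++-∷-injective α α′ (v∉α ∘ there) (v∉α′ ∘ there) eq′)

Unique-insertions : ∀ v (αs βs : List (List ℕ)) → Unique αs → Unique βs →
                    (∀ {α β} → α ∈ αs → β ∈ βs → v ∉ α) →
                    Unique (cartesianProductWith (λ α β → α ++ v ∷ β) αs βs)
Unique-insertions v []       βs _                _       _  = []
Unique-insertions v (α ∷ αs) βs (α∉αs ∷ unique-αs) unique-βs v∉ =
  Unique.++⁺ (Unique.map⁺ (λ eq → ∷-injectiveʳ (++-cancelˡ α _ _ eq)) unique-βs)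
             (Unique-insertions v αs βs unique-αs unique-βs (λ α∈ → v∉ (there α∈)))
             disjoint
  where
  disjoint : ∀ {π} → ¬ (π ∈ map (λ β → α ++ v ∷ β) βs ×
                        π ∈ cartesianProductWith (λ α β → α ++ v ∷ β) αs βs)
  disjoint (π∈ , π∈′) with β , β∈ , refl ← ∈-map⁻ (λ β → α ++ v ∷ β) π∈
                         | α′ , β′ , α′∈ , β′∈ , eq
                             ← ∈-cartesianProductWith⁻ (λ α β → α ++ v ∷ β) αs βs π∈′ =
    All.lookup α∉αs α′∈ (∉-++-∷-injective α α′ (v∉ (here refl) β∈) (v∉ (there α′∈) β′∈) eq)

Unique-middle : ∀ (α : List ℕ) {v β} → Unique (α ++ v ∷ β) → v ∉ α
Unique-middle α unique v∈α = Unique-++⇒disjoint α unique v∈α (here refl) refl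

module Avoiders (peak blocks : Dir) where

  IsAvoider : ℕ → ℕ → ℕ → List ℕ → Set
  IsAvoider lo n r π = π ↭ interval lo n × Alternating r π × PeakFree peak blocks π

  IsAvoider-join : ∀ lo r a c {α β} →
                   IsAvoider (leftStart blocks (restStart peak lo) a c) a r α →
                   IsAvoider (rightStart blocks (restStart peak lo) a c) c (suc (a + r)) β →
                   parity (peakValue peak lo (a + c)) ≡ parity (a + r) →
                   IsAvoider lo (suc (a + c)) r (α ++ peakValue peak lo (a + c) ∷ β)
  IsAvoider-join lo r a c {α} {β} (pα , altα , freeα) (pβ , altβ , freeβ) v-parity = perm , alt , free
    where
    v = peakValue peak lo (a + c)
    blocks↭ = interval-blocks blocks (restStart peak lo) a c
    perm : α ++ v ∷ β ↭ interval lo (suc (a + c))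
    perm = ↭-trans (shift v α β)
             (↭-trans (prep v (↭-trans (++⁺ pα pβ) blocks↭)) (↭-sym (interval-peak peak lo (a + c))))
    alt : Alternating r (α ++ v ∷ β)
    alt = Alternating-++⁺ r α (v ∷ β) altα
            (subst (λ s → Alternating (s + r) (v ∷ β)) (sym (trans (↭-length pα) (length-interval _ a)))
                   (v-parity , altβ))
    free : PeakFree peak blocks (α ++ v ∷ β)
    free = PeakFree-join peak blocks α v β freeα freeβ
      (λ x∈ z∈ → ∈-blocks⇒<[blocks] blocks (∈-resp-↭ pα x∈) (∈-resp-↭ pβ z∈))
      (λ w∈ → ∈-rest⇒<[peak] peak (∈-resp-↭ blocks↭ (∈-++⁺ˡ (∈-resp-↭ pα w∈))))
      (λ w∈ → ∈-rest⇒<[peak] peak (∈-resp-↭ blocks↭ (∈-++⁺ʳ _ (∈-resp-↭ pβ w∈))))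

  IsAvoider-split : ∀ lo n r α β → IsAvoider lo (suc n) r (α ++ peakValue peak lo n ∷ β) →
                    length α + length β ≡ n ×
                    IsAvoider (leftStart blocks (restStart peak lo) (length α) (length β)) (length α) r α ×
                    IsAvoider (rightStart blocks (restStart peak lo) (length α) (length β)) (length β)
                              (suc (length α + r)) β ×
                    parity (peakValue peak lo n) ≡ parity (length α + r)
  IsAvoider-split lo n r α β (p , alt , free) =
    a+c≡n , (proj₁ blocks↭ , altα , PeakFree-⊆ peak blocks (⊆-++⁺ʳ (v ∷ β) ⊆-refl) free)
          , (proj₂ blocks↭ , altβ , PeakFree-⊆ peak blocks (⊆-++⁺ˡ α (v ∷ʳ ⊆-refl)) free)
          , v-parity
    where
    v = peakValue peak lo n
    L = restStart peak lo
    pαβ : α ++ β ↭ interval L n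
    pαβ = drop-mid α [] (↭-trans p (interval-peak peak lo n))
    a+c≡n : length α + length β ≡ n
    a+c≡n = trans (sym (length-++ α)) (trans (↭-length pαβ) (length-interval L n))
    α<v : ∀ {w} → w ∈ α → w <[ peak ] v
    α<v w∈ = ∈-rest⇒<[peak] peak (∈-resp-↭ pαβ (∈-++⁺ˡ w∈))
    β<v : ∀ {w} → w ∈ β → w <[ peak ] v
    β<v w∈ = ∈-rest⇒<[peak] peak (∈-resp-↭ pαβ (∈-++⁺ʳ α w∈))
    α<β = PeakFree-blocks peak blocks α v β free α<v β<v
            (Unique-++⇒disjoint α (Unique-resp-↭ (↭-sym pαβ) (Unique-interval L n)))
    blocks↭ = interval-blocks⁻ blocks L α β (subst (λ m → α ++ β ↭ interval L m) (sym a+c≡n) pαβ) α<β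
    altα = proj₁ (Alternating-++⁻ r α (v ∷ β) alt)
    v-parity = proj₁ (proj₂ (Alternating-++⁻ r α (v ∷ β) alt))
    altβ = proj₂ (proj₂ (Alternating-++⁻ r α (v ∷ β) alt))

  peakParity? : ∀ lo r a c → Dec (parity (peakValue peak lo (a + c)) ≡ parity (a + r))
  peakParity? lo r a c = parity (peakValue peak lo (a + c)) ℙₚ.≟ parity (a + r)

  avoiders : ℕ → ℕ → ℕ → ℕ → List (List ℕ)
  avoidersSplitAt leftAvoiders rightAvoiders : ℕ → ℕ → ℕ → ℕ → ℕ → List (List ℕ)

  -- avoiders f lo n r lists the IsAvoider lo n r lists, provided the fuel f is at least n.
  avoiders f       lo zero    r = [] ∷ []
  avoiders zero    lo (suc n) r = []
  avoiders (suc f) lo (suc n) r = foldAntidiagonal _++_ (avoidersSplitAt f lo r) n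

  avoidersSplitAt f lo r a c =
    when (peakParity? lo r a c)
      (cartesianProductWith (λ α β → α ++ peakValue peak lo (a + c) ∷ β)
        (leftAvoiders f lo r a c) (rightAvoiders f lo r a c))

  leftAvoiders  f lo r a c = avoiders f (leftStart blocks (restStart peak lo) a c) a r
  rightAvoiders f lo r a c = avoiders f (rightStart blocks (restStart peak lo) a c) c (suc (a + r))

  avoiders-sound : ∀ f lo n r {π} → π ∈ avoiders f lo n r → IsAvoider lo n r π
  avoidersSplitAt-sound : ∀ f lo r a c {π} → π ∈ avoidersSplitAt f lo r a c → IsAvoider lo (suc (a + c)) r π

  avoiders-sound f       lo zero    r (here refl) = refl , tt , λ { (_ , _ , _ , () , _) }
  avoiders-sound (suc f) lo (suc n) r π∈ with a , c , refl , π∈′ ← ∈-foldAntidiagonal⁻ _ n π∈ =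
    avoidersSplitAt-sound f lo r a c π∈′

  avoidersSplitAt-sound f lo r a c π∈ with v-parity , π∈′ ← ∈-when⁻ (peakParity? lo r a c) π∈
    with α , β , α∈ , β∈ , refl ← ∈-cartesianProductWith⁻ (λ α β → α ++ peakValue peak lo (a + c) ∷ β)
                                                      (leftAvoiders f lo r a c) (rightAvoiders f lo r a c) π∈′ =
    IsAvoider-join lo r a c (avoiders-sound f _ a r α∈) (avoiders-sound f _ c _ β∈) v-parity

  avoiders-complete : ∀ f lo n r {π} → n ≤ f → IsAvoider lo n r π → π ∈ avoiders f lo n r
  avoiders-complete f lo zero r _ (p , _) with refl ← ↭-empty-inv p = here refl
  avoiders-complete (suc f) lo (suc n) r (s≤s n≤f) av@(p , _)
    with α , β , refl ← ∈-∃++ (∈-resp-↭ (↭-sym p) (∈-resp-↭ (↭-sym (interval-peak peak lo n)) (here refl)))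
    with IsAvoider-split lo n r α β av
  ... | refl , avα , avβ , v-parity =
    ∈-foldAntidiagonal⁺ (avoidersSplitAt f lo r) (length α) (length β)
      (∈-when⁺ (peakParity? lo r (length α) (length β)) v-parity (∈-cartesianProductWith⁺ _
        (avoiders-complete f _ _ r (≤-trans (m≤m+n _ _) n≤f) avα)
        (avoiders-complete f _ _ _ (≤-trans (m≤n+m _ _) n≤f) avβ)))

  avoidersSplitAt-shape : ∀ f lo r a c {π} → π ∈ avoidersSplitAt f lo r a c →
                          Σ (List ℕ) λ α → Σ (List ℕ) λ β →
                            π ≡ α ++ peakValue peak lo (a + c) ∷ β × length α ≡ a
  avoidersSplitAt-shape f lo r a c π∈ with _ , π∈′ ← ∈-when⁻ (peakParity? lo r a c) π∈
    with α , β , α∈ , _ , refl ← ∈-cartesianProductWith⁻ (λ α β → α ++ peakValue peak lo (a + c) ∷ β)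
                                                      (leftAvoiders f lo r a c) (rightAvoiders f lo r a c) π∈′ =
    α , β , refl , trans (↭-length (proj₁ (avoiders-sound f _ a r α∈))) (length-interval _ a)

  Unique-avoiders : ∀ f lo n r → Unique (avoiders f lo n r)
  Unique-avoidersSplitAt : ∀ f lo r a c → Unique (avoidersSplitAt f lo r a c)

  Unique-avoiders f       lo zero    r = [] ∷ []
  Unique-avoiders zero    lo (suc n) r = []
  Unique-avoiders (suc f) lo (suc n) r =
    Unique-foldAntidiagonal (avoidersSplitAt f lo r) n (λ a c _ → Unique-avoidersSplitAt f lo r a c) separated
    where
    -- the position of the extreme value tells the splits apart
    separated : ∀ {a c a′ c′ π} → a + c ≡ n → a′ + c′ ≡ n →
                π ∈ avoidersSplitAt f lo r a c → π ∈ avoidersSplitAt f lo r a′ c′ → a ≡ a′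
    separated {a} {c} {a′} {c′} refl a′+c′≡n π∈ π∈′
      with α , β , refl , |α|≡a ← avoidersSplitAt-shape f lo r a c π∈
         | α′ , β′ , eq , |α′|≡a′ ← avoidersSplitAt-shape f lo r a′ c′ π∈′
      rewrite a′+c′≡n =
      trans (sym |α|≡a) (trans (cong length (∉-++-∷-injective α α′ (Unique-middle α unique)
                                                (Unique-middle α′ (subst Unique eq unique)) eq)) |α′|≡a′)
      where
      unique = Unique-resp-↭ (↭-sym (proj₁ (avoidersSplitAt-sound f lo r a c π∈))) (Unique-interval lo _)

  Unique-avoidersSplitAt f lo r a c = Unique-when (peakParity? lo r a c) λ v-parity →
    Unique-insertions (peakValue peak lo (a + c)) _ _ (Unique-avoiders f _ a r) (Unique-avoiders f _ c _) λ α∈ β∈ →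
      Unique-middle _ (Unique-resp-↭ (↭-sym (proj₁ (IsAvoider-join lo r a c (avoiders-sound f _ a r α∈)
                                                      (avoiders-sound f _ c _ β∈) v-parity)))
                                     (Unique-interval lo _))

-- Counting the avoiders

module ℙ-Solver = RingSolver (ACR.fromCommutativeRing ℙₚ.+-*-commutativeRing) ℙₚ._≟_

ifEven : Parity → ℕ → ℕ
ifEven 0ℙ n = n
ifEven 1ℙ n = 0

length-when-≟ : ∀ {A : Set} p q (xs : List A) → length (when (p ℙₚ.≟ q) xs) ≡ ifEven (p ℙ.+ q) (length xs)
length-when-≟ 0ℙ 0ℙ xs = refl
length-when-≟ 0ℙ 1ℙ xs = refl
length-when-≟ 1ℙ 0ℙ xs = refl
length-when-≟ 1ℙ 1ℙ xs = refl

ifEven-sumAntidiagonal : ∀ p h n → sumAntidiagonal (λ a c → ifEven p (h a c)) n ≡ ifEven p (sumAntidiagonal h n)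
ifEven-sumAntidiagonal 0ℙ h n = refl
ifEven-sumAntidiagonal 1ℙ h n = sumAntidiagonal-zero n (λ _ _ → refl)

ifEven-complement : ∀ p n → ifEven p n + ifEven (p ℙ.+ 1ℙ) n ≡ n
ifEven-complement 0ℙ n = +-identityʳ n
ifEven-complement 1ℙ n = refl

countByParity : Parity → ℕ → Parity → ℕ
countByParity 0ℙ i _  = raney i 1
countByParity 1ℙ i 0ℙ = raney i 2
countByParity 1ℙ i 1ℙ = 0

-- The number of alternating avoiders of an interval of length n, when the parity of the
-- start position differs from that of the least value by δ: a misaligned odd interval has none.
avoiderCount : ℕ → Parity → ℕ
avoiderCount n δ = countByParity (parity n) ⌊ n /2⌋ δ

peakShift : Dir → Parity → Parity
peakShift ↑ p = p
peakShift ↓ p = 0ℙ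

restShift : Dir → Parity
restShift ↑ = 0ℙ
restShift ↓ = 1ℙ

leftShift rightShift : Dir → Parity → Parity
leftShift  ↑ p = 0ℙ
leftShift  ↓ p = p
rightShift ↑ p = p
rightShift ↓ p = 0ℙ

parity-peakValue : ∀ peak lo n → parity (peakValue peak lo n) ≡ parity lo ℙ.+ peakShift peak (parity n)
parity-peakValue ↑ lo n = +-homo-+ lo n
parity-peakValue ↓ lo n = sym (ℙ+-identityʳ (parity lo))

parity-restStart : ∀ peak lo → parity (restStart peak lo) ≡ parity lo ℙ.+ restShift peak
parity-restStart ↑ lo = sym (ℙ+-identityʳ (parity lo))
parity-restStart ↓ lo = trans (+-homo-+ 1 lo) (ℙ+-comm 1ℙ (parity lo))

parity-leftStart : ∀ blocks L a c → parity (leftStart blocks L a c) ≡ parity L ℙ.+ leftShift blocks (parity c)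
parity-leftStart ↑ L a c = sym (ℙ+-identityʳ (parity L))
parity-leftStart ↓ L a c = +-homo-+ L c

parity-rightStart : ∀ blocks L a c → parity (rightStart blocks L a c) ≡ parity L ℙ.+ rightShift blocks (parity a)
parity-rightStart ↑ L a c = +-homo-+ L a
parity-rightStart ↓ L a c = sym (ℙ+-identityʳ (parity L))

-- The number of avoiders whose extreme value has a = 2i + pa entries on its left and
-- c = 2j + pc on its right, in terms of the offset δ of the whole interval.
splitCountByParity : Dir → Dir → Parity → Parity → Parity → ℕ → ℕ → ℕ
splitCountByParity peak blocks δ pa pc i j =
  ifEven (δ ℙ.+ peakShift peak (pa ℙ.+ pc) ℙ.+ pa)
    (countByParity pa i (δ ℙ.+ restShift peak ℙ.+ leftShift blocks pc) *
     countByParity pc j (δ ℙ.+ restShift peak ℙ.+ rightShift blocks pa ℙ.+ pa ℙ.+ 1ℙ))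

splitCountByParity-even-even : ∀ peak blocks δ i j →
                               splitCountByParity peak blocks δ 0ℙ 0ℙ i j ≡ ifEven δ (raney i 1 * raney j 1)
splitCountByParity-even-even ↑ _ 0ℙ _ _ = refl
splitCountByParity-even-even ↑ _ 1ℙ _ _ = refl
splitCountByParity-even-even ↓ _ 0ℙ _ _ = refl
splitCountByParity-even-even ↓ _ 1ℙ _ _ = refl

splitCountByParity-odd-odd : ∀ peak blocks δ i j → splitCountByParity peak blocks δ 1ℙ 1ℙ i j ≡ 0
splitCountByParity-odd-odd ↑ _ 0ℙ _ _ = refl
splitCountByParity-odd-odd ↓ _ 0ℙ _ _ = refl
splitCountByParity-odd-odd ↑ ↑ 1ℙ _ _ = refl
splitCountByParity-odd-odd ↑ ↓ 1ℙ i _ = *-zeroʳ (raney i 2)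
splitCountByParity-odd-odd ↓ ↑ 1ℙ i _ = *-zeroʳ (raney i 2)
splitCountByParity-odd-odd ↓ ↓ 1ℙ _ _ = refl

splitCountByParity-even-odd : ∀ peak blocks δ i j →
                              splitCountByParity peak blocks δ 0ℙ 1ℙ i j ≡
                              ifEven (δ ℙ.+ peakShift peak 1ℙ) (raney i 1 * raney j 2)
splitCountByParity-even-odd ↑ _ 0ℙ _ _ = refl
splitCountByParity-even-odd ↑ ↑ 1ℙ _ _ = refl
splitCountByParity-even-odd ↑ ↓ 1ℙ _ _ = refl
splitCountByParity-even-odd ↓ ↑ 0ℙ _ _ = refl
splitCountByParity-even-odd ↓ ↓ 0ℙ _ _ = refl
splitCountByParity-even-odd ↓ _ 1ℙ _ _ = refl

splitCountByParity-odd-even : ∀ peak blocks δ i j →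
                              splitCountByParity peak blocks δ 1ℙ 0ℙ i j ≡
                              ifEven (δ ℙ.+ peakShift peak 1ℙ ℙ.+ 1ℙ) (raney i 2 * raney j 1)
splitCountByParity-odd-even ↑ ↑ 0ℙ _ _ = refl
splitCountByParity-odd-even ↑ ↓ 0ℙ _ _ = refl
splitCountByParity-odd-even ↑ _ 1ℙ _ _ = refl
splitCountByParity-odd-even ↓ _ 0ℙ _ _ = refl
splitCountByParity-odd-even ↓ ↑ 1ℙ _ _ = refl
splitCountByParity-odd-even ↓ ↓ 1ℙ _ _ = refl

avoiderCount-twice : ∀ m δ → avoiderCount (twice m) δ ≡ raney m 1
avoiderCount-twice m δ = cong₂ (λ p i → countByParity p i δ) (parity-twice m) (⌊twice/2⌋ m)

avoiderCount-suc-twice : ∀ m δ → avoiderCount (suc (twice m)) δ ≡ ifEven δ (raney m 2)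
avoiderCount-suc-twice m δ =
  trans (cong₂ (λ p i → countByParity p i δ) (parity-suc-twice m) (⌊suc-twice/2⌋ m)) (oddCount δ)
  where
  oddCount : ∀ δ → countByParity 1ℙ m δ ≡ ifEven δ (raney m 2)
  oddCount 0ℙ = refl
  oddCount 1ℙ = refl

module _ (peak blocks : Dir) (δ : Parity) where

  splitCount : ℕ → ℕ → ℕ
  splitCount a c = splitCountByParity peak blocks δ (parity a) (parity c) ⌊ a /2⌋ ⌊ c /2⌋

  splitCount≡ : ∀ {a c pa pc i j} → parity a ≡ pa → parity c ≡ pc → ⌊ a /2⌋ ≡ i → ⌊ c /2⌋ ≡ j →
                splitCount a c ≡ splitCountByParity peak blocks δ pa pc i j
  splitCount≡ refl refl refl refl = refl

  sumAntidiagonal-splitCount-even : ∀ m → sumAntidiagonal splitCount (twice (suc m)) ≡ ifEven δ (raney (suc m) 2)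
  sumAntidiagonal-splitCount-even m = begin
    sumAntidiagonal splitCount (twice (suc m))
      ≡⟨ sumAntidiagonal-twice m splitCount ⟩
    sumAntidiagonal (λ i j → splitCount (twice i) (twice j)) (suc m)
      + sumAntidiagonal (λ i j → splitCount (suc (twice i)) (suc (twice j))) m
      ≡⟨ cong₂ _+_ (sumAntidiagonal-cong (suc m) λ i j _ →
                      trans (splitCount≡ (parity-twice i) (parity-twice j) (⌊twice/2⌋ i) (⌊twice/2⌋ j))
                            (splitCountByParity-even-even peak blocks δ i j))
                   (sumAntidiagonal-zero m λ i j →
                      trans (splitCount≡ (parity-suc-twice i) (parity-suc-twice j) (⌊suc-twice/2⌋ i) (⌊suc-twice/2⌋ j))
                            (splitCountByParity-odd-odd peak blocks δ i j)) ⟩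
    sumAntidiagonal (λ i j → ifEven δ (raney i 1 * raney j 1)) (suc m) + 0
      ≡⟨ +-identityʳ _ ⟩
    sumAntidiagonal (λ i j → ifEven δ (raney i 1 * raney j 1)) (suc m)
      ≡⟨ ifEven-sumAntidiagonal δ (λ i j → raney i 1 * raney j 1) (suc m) ⟩
    ifEven δ (sumAntidiagonal (λ i j → raney i 1 * raney j 1) (suc m))
      ≡⟨ cong (ifEven δ) (raney-convolution (suc m) 1 1) ⟩
    ifEven δ (raney (suc m) 2) ∎
    where open ≡-Reasoning

  -- Exactly one of the two mixed parity classes survives, and both give the same convolution.
  sumAntidiagonal-splitCount-odd : ∀ m → sumAntidiagonal splitCount (suc (twice m)) ≡ raney m 3
  sumAntidiagonal-splitCount-odd m = begin
    sumAntidiagonal splitCount (suc (twice m))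
      ≡⟨ sumAntidiagonal-suc-twice m splitCount ⟩
    sumAntidiagonal (λ i j → splitCount (twice i) (suc (twice j))) m
      + sumAntidiagonal (λ i j → splitCount (suc (twice i)) (twice j)) m
      ≡⟨ cong₂ _+_ (sumAntidiagonal-cong m λ i j _ →
                      trans (splitCount≡ (parity-twice i) (parity-suc-twice j) (⌊twice/2⌋ i) (⌊suc-twice/2⌋ j))
                            (splitCountByParity-even-odd peak blocks δ i j))
                   (sumAntidiagonal-cong m λ i j _ →
                      trans (splitCount≡ (parity-suc-twice i) (parity-twice j) (⌊suc-twice/2⌋ i) (⌊twice/2⌋ j))
                            (splitCountByParity-odd-even peak blocks δ i j)) ⟩
    sumAntidiagonal (λ i j → ifEven g (raney i 1 * raney j 2)) m
      + sumAntidiagonal (λ i j → ifEven (g ℙ.+ 1ℙ) (raney i 2 * raney j 1)) m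
      ≡⟨ cong₂ _+_ (ifEven-sumAntidiagonal g (λ i j → raney i 1 * raney j 2) m)
                   (ifEven-sumAntidiagonal (g ℙ.+ 1ℙ) (λ i j → raney i 2 * raney j 1) m) ⟩
    ifEven g (sumAntidiagonal (λ i j → raney i 1 * raney j 2) m)
      + ifEven (g ℙ.+ 1ℙ) (sumAntidiagonal (λ i j → raney i 2 * raney j 1) m)
      ≡⟨ cong₂ (λ x y → ifEven g x + ifEven (g ℙ.+ 1ℙ) y) (raney-convolution m 1 2) (raney-convolution m 2 1) ⟩
    ifEven g (raney m 3) + ifEven (g ℙ.+ 1ℙ) (raney m 3)
      ≡⟨ ifEven-complement g (raney m 3) ⟩
    raney m 3 ∎
    where
    open ≡-Reasoning
    g = δ ℙ.+ peakShift peak 1ℙ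

  sumAntidiagonal-splitCount : ∀ n → sumAntidiagonal splitCount n ≡ avoiderCount (suc n) δ
  sumAntidiagonal-splitCount n with parityView n
  ... | even zero    = trans (splitCountByParity-even-even peak blocks δ 0 0) (sym (avoiderCount-suc-twice 0 δ))
  ... | even (suc m) = trans (sumAntidiagonal-splitCount-even m) (sym (avoiderCount-suc-twice (suc m) δ))
  ... | odd m        = trans (sumAntidiagonal-splitCount-odd m) (sym (avoiderCount-twice (suc m) δ))

module Counting (peak blocks : Dir) where

  open Avoiders peak blocks
  open ℙ-Solver using (solve; _:+_; _:=_; con)

  module _ (lo r a c : ℕ) where

    peak-parity : parity (peakValue peak lo (a + c)) ℙ.+ parity (a + r) ≡
                  parity lo ℙ.+ parity r ℙ.+ peakShift peak (parity a ℙ.+ parity c) ℙ.+ parity a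
    peak-parity = trans
      (cong₂ ℙ._+_ (trans (parity-peakValue peak lo (a + c))
                          (cong (λ p → parity lo ℙ.+ peakShift peak p) (+-homo-+ a c)))
                   (+-homo-+ a r))
      (solve 4 (λ l r′ a′ s → (l :+ s) :+ (a′ :+ r′) := (l :+ r′) :+ s :+ a′) refl
             (parity lo) (parity r) (parity a) (peakShift peak (parity a ℙ.+ parity c)))

    left-parity : parity (leftStart blocks (restStart peak lo) a c) ℙ.+ parity r ≡
                  parity lo ℙ.+ parity r ℙ.+ restShift peak ℙ.+ leftShift blocks (parity c)
    left-parity = trans
      (cong (ℙ._+ parity r) (trans (parity-leftStart blocks (restStart peak lo) a c)
                                   (cong (ℙ._+ leftShift blocks (parity c)) (parity-restStart peak lo))))
      (solve 4 (λ l r′ s t → ((l :+ s) :+ t) :+ r′ := (l :+ r′) :+ s :+ t) refl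
             (parity lo) (parity r) (restShift peak) (leftShift blocks (parity c)))

    right-parity : parity (rightStart blocks (restStart peak lo) a c) ℙ.+ parity (suc (a + r)) ≡
                   parity lo ℙ.+ parity r ℙ.+ restShift peak ℙ.+ rightShift blocks (parity a)
                     ℙ.+ parity a ℙ.+ 1ℙ
    right-parity = trans
      (cong₂ ℙ._+_ (trans (parity-rightStart blocks (restStart peak lo) a c)
                          (cong (ℙ._+ rightShift blocks (parity a)) (parity-restStart peak lo)))
                   (trans (+-homo-+ 1 (a + r)) (cong (1ℙ ℙ.+_) (+-homo-+ a r))))
      (solve 5 (λ l r′ a′ s t → ((l :+ s) :+ t) :+ (con 1ℙ :+ (a′ :+ r′))
                              := (l :+ r′) :+ s :+ t :+ a′ :+ con 1ℙ) refl
             (parity lo) (parity r) (parity a) (restShift peak) (rightShift blocks (parity a)))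

  length-avoiders : ∀ f lo n r → n ≤ f → length (avoiders f lo n r) ≡ avoiderCount n (parity lo ℙ.+ parity r)
  length-avoiders f       lo zero    r _         = refl
  length-avoiders (suc f) lo (suc n) r (s≤s n≤f) = begin
    length (foldAntidiagonal _++_ (avoidersSplitAt f lo r) n)
      ≡⟨ foldAntidiagonal-homo length (λ xs ys → length-++ xs) (avoidersSplitAt f lo r) n ⟩
    sumAntidiagonal (λ a c → length (avoidersSplitAt f lo r a c)) n
      ≡⟨ sumAntidiagonal-cong n (λ a c a+c≡n → length-avoidersSplitAt a c
           (≤-trans (m≤m+n a c) (subst (_≤ f) (sym a+c≡n) n≤f))
           (≤-trans (m≤n+m c a) (subst (_≤ f) (sym a+c≡n) n≤f))) ⟩
    sumAntidiagonal (splitCount peak blocks δ) n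
      ≡⟨ sumAntidiagonal-splitCount peak blocks δ n ⟩
    avoiderCount (suc n) δ ∎
    where
    open ≡-Reasoning
    δ = parity lo ℙ.+ parity r
    length-avoidersSplitAt : ∀ a c → a ≤ f → c ≤ f →
                             length (avoidersSplitAt f lo r a c) ≡ splitCount peak blocks δ a c
    length-avoidersSplitAt a c a≤f c≤f = begin
      length (avoidersSplitAt f lo r a c)
        ≡⟨ length-when-≟ (parity (peakValue peak lo (a + c))) (parity (a + r)) _ ⟩
      ifEven (parity (peakValue peak lo (a + c)) ℙ.+ parity (a + r))
             (length (cartesianProductWith _ (leftAvoiders f lo r a c) (rightAvoiders f lo r a c)))
        ≡⟨ cong₂ ifEven (peak-parity lo r a c) (length-cartesianProductWith _ (leftAvoiders f lo r a c) _) ⟩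
      ifEven (δ ℙ.+ peakShift peak (parity a ℙ.+ parity c) ℙ.+ parity a)
             (length (leftAvoiders f lo r a c) * length (rightAvoiders f lo r a c))
        ≡⟨ cong (ifEven _) (cong₂ _*_
             (trans (length-avoiders f _ a r a≤f) (cong (countByParity (parity a) ⌊ a /2⌋) (left-parity lo r a c)))
             (trans (length-avoiders f _ c _ c≤f) (cong (countByParity (parity c) ⌊ c /2⌋) (right-parity lo r a c)))) ⟩
      splitCount peak blocks δ a c ∎

-- Parity-alternating permutations avoiding σ

module _ {σ} (P : Pattern σ) where

  open Avoiders (peakOf P) (blocksOf P)
  open Counting (peakOf P) (blocksOf P)

  IsAvoider⇔PAP : ∀ n π → IsAvoider 1 n 1 π ⇔ (IsPAP n π × Avoids π σ)
  IsAvoider⇔PAP n π = mk⇔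
    (λ (p , alt , free) → (subst (π ↭_) (sym (map-suc-upTo n)) p , Equivalence.from (lookup-%2⇔Alternating 1 π) alt)
                        , λ c → free (Equivalence.to (Contains⇔ContainsPeaked P) c))
    (λ ((p , pa) , avoids) → subst (π ↭_) (map-suc-upTo n) p , Equivalence.to (lookup-%2⇔Alternating 1 π) pa
                           , λ c → avoids (Equivalence.from (Contains⇔ContainsPeaked P) c))

  PAPcount-avoiderCount : ∀ n → PAPcount σ n (avoiderCount n 0ℙ)
  PAPcount-avoiderCount n =
    avoiders n 1 n 1 , Unique-avoiders n 1 n 1 ,
    (λ π → mk⇔ (λ π∈ → Equivalence.to (IsAvoider⇔PAP n π) (avoiders-sound n 1 n 1 π∈))
               (λ pap → avoiders-complete n 1 n 1 ≤-refl (Equivalence.from (IsAvoider⇔PAP n π) pap))) ,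
    length-avoiders n 1 n 1 ≤-refl

mainTheorem15 : (σ : List ℕ) → Pattern σ → (m : ℕ) →
    Σ ℕ (λ k → PAPcount σ (2 * m) k × (suc (2 * m) * k ≡ (3 * m) C m))
    × Σ ℕ (λ k → PAPcount σ (suc (2 * m)) k × (suc (2 * m) * k ≡ (suc (3 * m)) C (suc m)))
mainTheorem15 σ P m =
  (raney m 1 , subst (PAPcount σ (2 * m)) even-count (PAPcount-avoiderCount P (2 * m)) , [1+2m]*raney[m,1]≡3mCm m) ,
  (raney m 2 , subst (PAPcount σ (suc (2 * m))) odd-count (PAPcount-avoiderCount P (suc (2 * m))) ,
   [1+2m]*raney[m,2]≡[1+3m]C[1+m] m)
  where
  even-count : avoiderCount (2 * m) 0ℙ ≡ raney m 1
  even-count = trans (cong (λ n → avoiderCount n 0ℙ) (2*m≡twice m)) (avoiderCount-twice m 0ℙ)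
  odd-count : avoiderCount (suc (2 * m)) 0ℙ ≡ raney m 2
  odd-count = trans (cong (λ n → avoiderCount (suc n) 0ℙ) (2*m≡twice m)) (avoiderCount-suc-twice m 0ℙ)
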